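{- $\mathrm{SCL}<\forall\mathrm{SO}$ in expressive power: for every formula of $\mathrm{SCL}$ there is a formula of universal second-order logic $\forall\mathrm{SO}$ true in exactly the same suitable models under the same suitable assignments, but there is a formula of $\forall\mathrm{SO}$ for which no such formula of $\mathrm{SCL}$ exists.
   Context: $\forall\mathrm{SO}$ consists of formulas $\forall X_1\dots\forall X_n\,\psi$ with $X_i$ second-order relation variables and $\psi$ first-order. Syntax of $\mathrm{SCL}$. Fix purely relational vocabularies. $\mathrm{FO}$ has equality and $\bot$ as primitives and $\neg,\wedge,\vee,\exists,\forall$. Fix label symbols $L_0,L_1,\dots$ and for each $L$ a claim symbol $C_L$. Formulas: $\mathrm{FO}$ formation rules plus: each $C_L$ is atomic (no free variables); if $\varphi$ is a formula, $L\varphi$ is a formula (same free variables). FO-atoms are atomic formulas of $\mathrm{FO}$. The reference formula of an occurrence of $C_L$ is the subformula occurrence $L\psi$ above it in the syntax tree with no occurrence of $L$ strictly between (if any). Semantics. $\mathcal{G}_\infty(\mathfrak{A},s,\varphi)$ has positions $(\psi,r,\#)$, $\#\in\{+,-\}$, starting at $(\varphi,s,+)$. FO-atom $\alpha$: if $\#=+$ Eloise wins iff $\mathfrak{A},r\models\alpha$, else Abelard; if $\#=-$ Abelard wins iff $\mathfrak{A},r\models\alpha$, else Eloise. $\neg$ flips the sign. $\wedge$: Abelard chooses if $+$, Eloise if $-$. $\vee$: Eloise if $+$, Abelard if $-$. $\forall x$: Abelard picks $a\in A$ if $+$, Eloise if $-$, assignment becomes $r[a/x]$. $\exists x$: Eloise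 if $+$, Abelard if $-$. $L\psi$: move to $\psi$. $C_L$: move to its reference formula (no winner if none). Infinite plays have no winner. $\mathfrak{A},s\models\varphi$ iff Eloise has a winning strategy. -}

module Defs where

open import Level using (Level; 0ℓ) renaming (suc to lsuc)
open import Data.Nat using (ℕ; _≟_)
open import Data.Fin using (Fin)
open import Data.Vec using (Vec) renaming (map to vmap)
open import Data.List using (List; []; _∷_)
open import Data.Maybe using (Maybe; just; nothing)
open import Data.Product using (Σ; _×_; _,_)
open import Data.Sum using (_⊎_; inj₁; inj₂)
open import Data.Empty using (⊥)
open import Relation.Nullary using (¬_; yes; no)
open import Relation.Binary.PropositionalEquality using (_≡_)
open import Axiom.ExcludedMiddle using (ExcludedMiddle) public

record Vocab : Set₁ where
  field
    Sym : Set
    ar  : Sym → ℕ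
open Vocab public

Var : Set
Var = ℕ

Label : Set
Label = ℕ

record Structure (τ : Vocab) : Set₁ where
  field
    Carrier : Set
    relOf   : (R : Sym τ) → Vec Carrier (ar τ R) → Set
open Structure public

-- total assignments (they cover every "suitable" assignment)
Assignment : {τ : Vocab} → Structure τ → Set
Assignment M = Var → Carrier M

_[_/_] : {A : Set} → (Var → A) → A → Var → (Var → A)
(r [ a / x ]) y with y ≟ x
... | yes _ = a
... | no  _ = r y

data Atom (τ : Vocab) : Set where
  rel : (R : Sym τ) → Vec Var (ar τ R) → Atom τ
  eq  : Var → Var → Atom τ
  bot : Atom τ

AtomSat : {τ : Vocab} (M : Structure τ) → Assignment M → Atom τ → Set
AtomSat M r (rel R xs) = relOf M R (vmap r xs)
AtomSat M r (eq x y)   = r x ≡ r y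
AtomSat M r bot        = ⊥

data FO (τ : Vocab) : Set where
  fatom : Atom τ → FO τ
  fneg  : FO τ → FO τ
  fand  : FO τ → FO τ → FO τ
  for   : FO τ → FO τ → FO τ
  fex   : Var → FO τ → FO τ
  fall  : Var → FO τ → FO τ

FOSat : {τ : Vocab} (M : Structure τ) → Assignment M → FO τ → Set
FOSat M r (fatom α)  = AtomSat M r α
FOSat M r (fneg φ)   = ¬ FOSat M r φ
FOSat M r (fand φ ψ) = FOSat M r φ × FOSat M r ψ
FOSat M r (for φ ψ)  = FOSat M r φ ⊎ FOSat M r ψ
FOSat M r (fex x φ)  = Σ (Carrier M) (λ a → FOSat M (r [ a / x ]) φ)
FOSat M r (fall x φ) = (a : Carrier M) → FOSat M (r [ a / x ]) φ

-- Universal second-order logic:  ∀X₀ … ∀X_{k-1} ψ,  ψ first-order over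
-- the vocabulary τ extended by the relation variables X_i (arity arX i)

extend : (τ : Vocab) {k : ℕ} → (Fin k → ℕ) → Vocab
extend τ {k} arX = record { Sym = Sym τ ⊎ Fin k ; ar = arities }
  where
  arities : Sym τ ⊎ Fin k → ℕ
  arities (inj₁ R) = ar τ R
  arities (inj₂ i) = arX i

record ASO (τ : Vocab) : Set where
  field
    k    : ℕ
    arX  : Fin k → ℕ
    body : FO (extend τ arX)
open ASO public

expandStr : {τ : Vocab} (M : Structure τ) {k : ℕ} (arX : Fin k → ℕ) →
            ((i : Fin k) → Vec (Carrier M) (arX i) → Set) →
            Structure (extend τ arX)
expandStr {τ} M {k} arX Xs = record { Carrier = Carrier M ; relOf = interp }
  where
  interp : (R : Sym τ ⊎ Fin k) → Vec (Carrier M) (ar (extend τ arX) R) → Set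
  interp (inj₁ R) = relOf M R
  interp (inj₂ i) = Xs i

ASOSat : {τ : Vocab} (M : Structure τ) → Assignment M → ASO τ → Set₁
ASOSat M r ψ =
  (Xs : (i : Fin (k ψ)) → Vec (Carrier M) (arX ψ i) → Set) →
  FOSat (expandStr M (arX ψ) Xs) r (body ψ)

data SCL (τ : Vocab) : Set where
  atom  : Atom τ → SCL τ
  neg   : SCL τ → SCL τ
  and   : SCL τ → SCL τ → SCL τ
  or    : SCL τ → SCL τ → SCL τ
  ex    : Var → SCL τ → SCL τ
  all   : Var → SCL τ → SCL τ
  lab   : Label → SCL τ → SCL τ
  claim : Label → SCL τ

-- Subformula occurrences are represented as zippers: a subformula
-- together with the list of frames leading up to the root (innermost first).
data Frame (τ : Vocab) : Set where
  negF : Frame τ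
  andL : SCL τ → Frame τ     -- we are the left conjunct; argument = right one
  andR : SCL τ → Frame τ     -- we are the right conjunct; argument = left one
  orL  : SCL τ → Frame τ
  orR  : SCL τ → Frame τ
  exF  : Var → Frame τ
  allF : Var → Frame τ
  labF : Label → Frame τ

Ctx : Vocab → Set
Ctx τ = List (Frame τ)

plug : {τ : Vocab} → Frame τ → SCL τ → SCL τ
plug negF     ψ = neg ψ
plug (andL χ) ψ = and ψ χ
plug (andR χ) ψ = and χ ψ
plug (orL χ)  ψ = or ψ χ
plug (orR χ)  ψ = or χ ψ
plug (exF x)  ψ = ex x ψ
plug (allF x) ψ = all x ψ
plug (labF L) ψ = lab L ψ

refOcc : {τ : Vocab} → Label → SCL τ → Ctx τ → Maybe (SCL τ × Ctx τ)
refOcc L ψ [] = nothing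
refOcc L ψ (labF K ∷ c) with L ≟ K
... | yes _ = just (lab K ψ , c)
... | no  _ = refOcc L (lab K ψ) c
refOcc L ψ (negF   ∷ c) = refOcc L (plug negF ψ) c
refOcc L ψ (andL χ ∷ c) = refOcc L (plug (andL χ) ψ) c
refOcc L ψ (andR χ ∷ c) = refOcc L (plug (andR χ) ψ) c
refOcc L ψ (orL χ  ∷ c) = refOcc L (plug (orL χ) ψ) c
refOcc L ψ (orR χ  ∷ c) = refOcc L (plug (orR χ) ψ) c
refOcc L ψ (exF x  ∷ c) = refOcc L (plug (exF x) ψ) c
refOcc L ψ (allF x ∷ c) = refOcc L (plug (allF x) ψ) c

-- Positions: (occurrence (ψ , c), assignment r, sign #).
-- EWin M r # ψ c  is the type of (well-founded) winning strategies of Eloise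
-- from that position: every play following it ends, after finitely many moves,
-- in a win for Eloise (infinite plays have no winner, so they are not wins).

data Sign : Set where
  plus minus : Sign

flipSign : Sign → Sign
flipSign plus  = minus
flipSign minus = plus

data EWin {τ : Vocab} (M : Structure τ) :
          Assignment M → Sign → SCL τ → Ctx τ → Set where
  atom+ : ∀ {r α c} → AtomSat M r α → EWin M r plus (atom α) c
  atom- : ∀ {r α c} → ¬ AtomSat M r α → EWin M r minus (atom α) c
  neg±  : ∀ {r σ φ c} → EWin M r (flipSign σ) φ (negF ∷ c) → EWin M r σ (neg φ) c
  and+  : ∀ {r φ ψ c} → EWin M r plus φ (andL ψ ∷ c) → EWin M r plus ψ (andR φ ∷ c) →
          EWin M r plus (and φ ψ) c
  and-l : ∀ {r φ ψ c} → EWin M r minus φ (andL ψ ∷ c) → EWin M r minus (and φ ψ) c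
  and-r : ∀ {r φ ψ c} → EWin M r minus ψ (andR φ ∷ c) → EWin M r minus (and φ ψ) c
  or+l  : ∀ {r φ ψ c} → EWin M r plus φ (orL ψ ∷ c) → EWin M r plus (or φ ψ) c
  or+r  : ∀ {r φ ψ c} → EWin M r plus ψ (orR φ ∷ c) → EWin M r plus (or φ ψ) c
  or-   : ∀ {r φ ψ c} → EWin M r minus φ (orL ψ ∷ c) → EWin M r minus ψ (orR φ ∷ c) →
          EWin M r minus (or φ ψ) c
  all+  : ∀ {r x φ c} → ((a : Carrier M) → EWin M (r [ a / x ]) plus φ (allF x ∷ c)) →
          EWin M r plus (all x φ) c
  all-  : ∀ {r x φ c} (a : Carrier M) → EWin M (r [ a / x ]) minus φ (allF x ∷ c) →
          EWin M r minus (all x φ) c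
  ex+   : ∀ {r x φ c} (a : Carrier M) → EWin M (r [ a / x ]) plus φ (exF x ∷ c) →
          EWin M r plus (ex x φ) c
  ex-   : ∀ {r x φ c} → ((a : Carrier M) → EWin M (r [ a / x ]) minus φ (exF x ∷ c)) →
          EWin M r minus (ex x φ) c
  lab±  : ∀ {r σ L φ c} → EWin M r σ φ (labF L ∷ c) → EWin M r σ (lab L φ) c
  -- C_L : move to its reference formula (no move, hence no win, if there is none)
  claim± : ∀ {r σ L c χ c'} → refOcc L (claim L) c ≡ just (χ , c') →
           EWin M r σ χ c' → EWin M r σ (claim L) c

SCLSat : {τ : Vocab} (M : Structure τ) → Assignment M → SCL τ → Set
SCLSat M s φ = EWin M s plus φ []

Equivalent : {τ : Vocab} → SCL τ → ASO τ → Set₁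
Equivalent {τ} φ ψ =
  (M : Structure τ) (s : Assignment M) →
  (SCLSat M s φ → ASOSat M s ψ) × (ASOSat M s ψ → SCLSat M s φ)

-- Eloise's winning positions in G∞(M, s, φ) form the least set of positions closed under the
-- one-step rules of the game (Step below). A position consists of a sign, an occurrence in φ and
-- an assignment, of which only the variables below N = bound φ matter; so a set of positions can
-- be given by N-ary relations X_{σ,c}, one per sign and occurrence. The ∀SO translation of φ says
-- that every such family closed under the rules, a first-order condition, contains the initial
-- position. Excluded middle is needed only to read first-order implication classically.
--
-- Over the empty vocabulary an SCL formula sees only the equality type of its first N variables,
-- which every structure with more than N elements realises, so by a back-and-forth argument
-- winning strategies transfer from Fin (suc N) to ℕ. Dedekind finiteness is a ∀SO sentence true
-- in the former and false in the latter.

module Submission where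

open import Defs
open import Level using (0ℓ; Lift; lift) renaming (suc to lsuc)
open import Data.Bool using (Bool; true; false; if_then_else_)
open import Data.Nat using (ℕ; zero; suc; _+_; _≤_; _<_; _⊔_; s≤s; _≟_)
open import Data.Nat.Properties
  using (≤-refl; ≤-trans; <⇒≤; <-≤-trans; <-irrefl; ≤⇒≯; n<1+n; +-suc; +-monoʳ-≤; m≤m+n; m≤m⊔n; m≤n⊔m;
         m<n⇒m<n⊔o; m<n⇒m<o⊔n; m≤n⇒m≤1+n; ≤∧≢⇒<; suc-injective; anyUpTo?; allUpTo?; module ≤-Reasoning)
open import Data.Fin as Fin using (Fin; toℕ; fromℕ<; join; splitAt; punchOut)
import Data.Fin.Properties as Finₚ
open import Data.Vec using (Vec; []; _∷_; head; tail) renaming (map to vmap)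
open import Data.Vec.Relation.Unary.All using ([]; _∷_) renaming (All to VAll; map to VAll-map)
open import Data.List using (List; []; _∷_; length; map)
open import Data.List.Properties using (length-map; ∷-injective; ∷-injectiveˡ; ∷-injectiveʳ)
open import Data.Maybe using (Maybe; just; nothing)
open import Data.Maybe.Properties using (just-injective)
open import Data.Product using (Σ; ∃-syntax; _×_; _,_; proj₁; proj₂)
open import Data.Sum using (_⊎_; inj₁; inj₂)
open import Data.Sum.Properties using (inj₁-injective; inj₂-injective)
open import Data.Empty using (⊥; ⊥-elim)
open import Data.Unit using (⊤; tt)
open import Function using (id)
open import Function.Definitions using (Injective)
open import Relation.Nullary using (¬_; yes; no)
open import Relation.Nullary.Decidable using (decidable-stable; ¬?)
open import Relation.Binary.Definitions using (DecidableEquality)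
open import Relation.Binary.PropositionalEquality using (_≡_; _≢_; refl; sym; trans; cong; cong₂; subst)

private
  variable
    A B : Set
    τ : Vocab
    n : ℕ
    L : Label

plugAll : SCL τ → Ctx τ → SCL τ
plugAll χ []      = χ
plugAll χ (f ∷ c) = plugAll (plug f χ) c

refOcc-plugAll : (ψ : SCL τ) (c : Ctx τ) {χ : SCL τ} {c' : Ctx τ} →
                 refOcc L ψ c ≡ just (χ , c') → plugAll χ c' ≡ plugAll ψ c
refOcc-plugAll         ψ []            ()
refOcc-plugAll {L = L} ψ (labF K ∷ c)  e with L ≟ K
refOcc-plugAll         ψ (labF K ∷ c)  refl | yes _ = refl
refOcc-plugAll         ψ (labF K ∷ c)  e    | no _  = refOcc-plugAll (lab K ψ) c e
refOcc-plugAll         ψ (negF   ∷ c)  e = refOcc-plugAll (neg ψ) c e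
refOcc-plugAll         ψ (andL χ ∷ c)  e = refOcc-plugAll (and ψ χ) c e
refOcc-plugAll         ψ (andR χ ∷ c)  e = refOcc-plugAll (and χ ψ) c e
refOcc-plugAll         ψ (orL χ  ∷ c)  e = refOcc-plugAll (or ψ χ) c e
refOcc-plugAll         ψ (orR χ  ∷ c)  e = refOcc-plugAll (or χ ψ) c e
refOcc-plugAll         ψ (exF x  ∷ c)  e = refOcc-plugAll (ex x ψ) c e
refOcc-plugAll         ψ (allF x ∷ c)  e = refOcc-plugAll (all x ψ) c e

-- An occurrence is determined by the formula around it and its left/right path.
side : Frame τ → Bool
side (andR _) = true
side (orR _)  = true
side _        = false

unplug : Bool → SCL τ → Maybe (Frame τ × SCL τ)
unplug false (neg χ)   = just (negF , χ)
unplug false (and χ ψ) = just (andL ψ , χ)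
unplug true  (and χ ψ) = just (andR χ , ψ)
unplug false (or χ ψ)  = just (orL ψ , χ)
unplug true  (or χ ψ)  = just (orR χ , ψ)
unplug false (ex x χ)  = just (exF x , χ)
unplug false (all x χ) = just (allF x , χ)
unplug false (lab L χ) = just (labF L , χ)
unplug _     _         = nothing

unplug-plug : (f : Frame τ) (χ : SCL τ) → unplug (side f) (plug f χ) ≡ just (f , χ)
unplug-plug negF     χ = refl
unplug-plug (andL _) χ = refl
unplug-plug (andR _) χ = refl
unplug-plug (orL _)  χ = refl
unplug-plug (orR _)  χ = refl
unplug-plug (exF _)  χ = refl
unplug-plug (allF _) χ = refl
unplug-plug (labF _) χ = refl

plug-injective : {f f' : Frame τ} {χ χ' : SCL τ} →
                 side f ≡ side f' → plug f χ ≡ plug f' χ' → (f , χ) ≡ (f' , χ')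
plug-injective {f = f} {f'} {χ} {χ'} s e =
  just-injective (trans (sym (unplug-plug f χ)) (trans (cong₂ unplug s e) (unplug-plug f' χ')))

plugAll-injective : {χ χ' : SCL τ} {c c' : Ctx τ} → map side c ≡ map side c' →
                    plugAll χ c ≡ plugAll χ' c' → χ ≡ χ' × c ≡ c'
plugAll-injective {c = []}    {[]}      _ e = e , refl
plugAll-injective {c = _ ∷ _} {_ ∷ _} s e
  with e' , refl ← plugAll-injective (∷-injectiveʳ s) e
  with refl ← plug-injective (∷-injectiveˡ s) e'
  = refl , refl

depth : SCL τ → ℕ
depth (atom _)  = 0
depth (neg φ)   = suc (depth φ)
depth (and φ ψ) = suc (depth φ ⊔ depth ψ)
depth (or φ ψ)  = suc (depth φ ⊔ depth ψ)
depth (ex _ φ)  = suc (depth φ)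
depth (all _ φ) = suc (depth φ)
depth (lab _ φ) = suc (depth φ)
depth (claim _) = 0

depth-plug : (f : Frame τ) (χ : SCL τ) → depth χ < depth (plug f χ)
depth-plug negF     χ = ≤-refl
depth-plug (andL _) χ = s≤s (m≤m⊔n _ _)
depth-plug (andR _) χ = s≤s (m≤n⊔m _ _)
depth-plug (orL _)  χ = s≤s (m≤m⊔n _ _)
depth-plug (orR _)  χ = s≤s (m≤n⊔m _ _)
depth-plug (exF _)  χ = ≤-refl
depth-plug (allF _) χ = ≤-refl
depth-plug (labF _) χ = ≤-refl

length+depth≤depth-plugAll : (χ : SCL τ) (c : Ctx τ) → length c + depth χ ≤ depth (plugAll χ c)
length+depth≤depth-plugAll χ []      = ≤-refl
length+depth≤depth-plugAll χ (f ∷ c) = begin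
  suc (length c + depth χ)    ≡⟨ sym (+-suc (length c) (depth χ)) ⟩
  length c + suc (depth χ)    ≤⟨ +-monoʳ-≤ (length c) (depth-plug f χ) ⟩
  length c + depth (plug f χ) ≤⟨ length+depth≤depth-plugAll (plug f χ) c ⟩
  depth (plugAll χ (f ∷ c))   ∎
  where open ≤-Reasoning

length≤depth : {φ : SCL τ} (χ : SCL τ) (c : Ctx τ) → plugAll χ c ≡ φ → length c ≤ depth φ
length≤depth χ c refl = ≤-trans (m≤m+n _ _) (length+depth≤depth-plugAll χ c)

AtomVarsBelow : ℕ → Atom τ → Set
AtomVarsBelow N (rel R xs) = VAll (_< N) xs
AtomVarsBelow N (eq x y)   = x < N × y < N
AtomVarsBelow N bot        = ⊤

-- Only variables in atoms are bounded: quantified variables need no bound.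
VarsBelow : ℕ → SCL τ → Set
VarsBelow N (atom α)  = AtomVarsBelow N α
VarsBelow N (neg φ)   = VarsBelow N φ
VarsBelow N (and φ ψ) = VarsBelow N φ × VarsBelow N ψ
VarsBelow N (or φ ψ)  = VarsBelow N φ × VarsBelow N ψ
VarsBelow N (ex _ φ)  = VarsBelow N φ
VarsBelow N (all _ φ) = VarsBelow N φ
VarsBelow N (lab _ φ) = VarsBelow N φ
VarsBelow N (claim _) = ⊤

AtomVarsBelow-mono : {N N' : ℕ} (α : Atom τ) → N ≤ N' → AtomVarsBelow N α → AtomVarsBelow N' α
AtomVarsBelow-mono (rel R xs) le b       = VAll-map (λ x< → <-≤-trans x< le) b
AtomVarsBelow-mono (eq x y)   le (p , q) = <-≤-trans p le , <-≤-trans q le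
AtomVarsBelow-mono bot        le b       = tt

VarsBelow-mono : {N N' : ℕ} (φ : SCL τ) → N ≤ N' → VarsBelow N φ → VarsBelow N' φ
VarsBelow-mono (atom α)  le b       = AtomVarsBelow-mono α le b
VarsBelow-mono (neg φ)   le b       = VarsBelow-mono φ le b
VarsBelow-mono (and φ ψ) le (b , d) = VarsBelow-mono φ le b , VarsBelow-mono ψ le d
VarsBelow-mono (or φ ψ)  le (b , d) = VarsBelow-mono φ le b , VarsBelow-mono ψ le d
VarsBelow-mono (ex _ φ)  le b       = VarsBelow-mono φ le b
VarsBelow-mono (all _ φ) le b       = VarsBelow-mono φ le b
VarsBelow-mono (lab _ φ) le b       = VarsBelow-mono φ le b
VarsBelow-mono (claim _) le b       = tt

VarsBelow-⊔ : {N N' : ℕ} (φ ψ : SCL τ) → VarsBelow N φ → VarsBelow N' ψ →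
              VarsBelow (N ⊔ N') φ × VarsBelow (N ⊔ N') ψ
VarsBelow-⊔ φ ψ b b' = VarsBelow-mono φ (m≤m⊔n _ _) b , VarsBelow-mono ψ (m≤n⊔m _ _) b'

vecBound : Vec Var n → ℕ
vecBound []       = 0
vecBound (x ∷ xs) = suc x ⊔ vecBound xs

vecBound-correct : (xs : Vec Var n) → VAll (_< vecBound xs) xs
vecBound-correct []       = []
vecBound-correct (x ∷ xs) =
  m<n⇒m<n⊔o (vecBound xs) (n<1+n x) ∷ VAll-map (m<n⇒m<o⊔n (suc x)) (vecBound-correct xs)

atomBound : Atom τ → ℕ
atomBound (rel R xs) = vecBound xs
atomBound (eq x y)   = suc x ⊔ suc y
atomBound bot        = 0

atomBound-correct : (α : Atom τ) → AtomVarsBelow (atomBound α) α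
atomBound-correct (rel R xs) = vecBound-correct xs
atomBound-correct (eq x y)   = m<n⇒m<n⊔o (suc y) (n<1+n x) , m<n⇒m<o⊔n (suc x) (n<1+n y)
atomBound-correct bot        = tt

bound : SCL τ → ℕ
bound (atom α)  = atomBound α
bound (neg φ)   = bound φ
bound (and φ ψ) = bound φ ⊔ bound ψ
bound (or φ ψ)  = bound φ ⊔ bound ψ
bound (ex _ φ)  = bound φ
bound (all _ φ) = bound φ
bound (lab _ φ) = bound φ
bound (claim _) = 0

bound-correct : (φ : SCL τ) → VarsBelow (bound φ) φ
bound-correct (atom α)  = atomBound-correct α
bound-correct (neg φ)   = bound-correct φ
bound-correct (and φ ψ) = VarsBelow-⊔ φ ψ (bound-correct φ) (bound-correct ψ)
bound-correct (or φ ψ)  = VarsBelow-⊔ φ ψ (bound-correct φ) (bound-correct ψ)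
bound-correct (ex _ φ)  = bound-correct φ
bound-correct (all _ φ) = bound-correct φ
bound-correct (lab _ φ) = bound-correct φ
bound-correct (claim _) = tt

VarsBelow-plug : {N : ℕ} (f : Frame τ) (χ : SCL τ) → VarsBelow N (plug f χ) → VarsBelow N χ
VarsBelow-plug negF     χ b = b
VarsBelow-plug (andL _) χ b = proj₁ b
VarsBelow-plug (andR _) χ b = proj₂ b
VarsBelow-plug (orL _)  χ b = proj₁ b
VarsBelow-plug (orR _)  χ b = proj₂ b
VarsBelow-plug (exF _)  χ b = b
VarsBelow-plug (allF _) χ b = b
VarsBelow-plug (labF _) χ b = b

VarsBelow-plugAll : {N : ℕ} (χ : SCL τ) (c : Ctx τ) → VarsBelow N (plugAll χ c) → VarsBelow N χ
VarsBelow-plugAll χ []      b = b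
VarsBelow-plugAll χ (f ∷ c) b = VarsBelow-plug f χ (VarsBelow-plugAll (plug f χ) c b)

Agree : ℕ → (Var → A) → (Var → A) → Set
Agree N r r' = ∀ {j} → j < N → r j ≡ r' j

Agree-sym : {N : ℕ} {r r' : Var → A} → Agree N r r' → Agree N r' r
Agree-sym ag j< = sym (ag j<)

Agree-[/] : {N : ℕ} {r r' : Var → A} (a : A) (x : Var) → Agree N r r' → Agree N (r [ a / x ]) (r' [ a / x ])
Agree-[/] a x ag {j} j< with j ≟ x
... | yes _ = refl
... | no _  = ag j<

vmap-Agree : {N : ℕ} {r r' : Var → A} (ys : Vec Var n) → VAll (_< N) ys → Agree N r r' → vmap r ys ≡ vmap r' ys
vmap-Agree []       []         ag = refl
vmap-Agree (y ∷ ys) (y< ∷ ys<) ag = cong₂ _∷_ (ag y<) (vmap-Agree ys ys< ag)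

AtomSat-Agree : {N : ℕ} (M : Structure τ) {r r' : Assignment M} (α : Atom τ) →
                AtomVarsBelow N α → Agree N r r' → AtomSat M r α → AtomSat M r' α
AtomSat-Agree M (rel R ys) b        ag p = subst (relOf M R) (vmap-Agree ys b ag) p
AtomSat-Agree M (eq x y)   (x< , y<) ag p = trans (sym (ag x<)) (trans p (ag y<))
AtomSat-Agree M bot        _        ag ()

vars : (n : ℕ) → Vec Var n
vars zero    = []
vars (suc n) = n ∷ vars n

vars-below : (n : ℕ) → VAll (_< n) (vars n)
vars-below zero    = []
vars-below (suc n) = ≤-refl ∷ VAll-map m≤n⇒m≤1+n (vars-below n)

vmap-vars⇒Agree : (n : ℕ) {r r' : Var → A} → vmap r (vars n) ≡ vmap r' (vars n) → Agree n r r'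
vmap-vars⇒Agree (suc n) e {j} (s≤s j≤n) with j ≟ n
... | yes refl = cong head e
... | no j≢n   = vmap-vars⇒Agree n (cong tail e) (≤∧≢⇒< j≤n j≢n)

[/]-same : (r : Var → A) (a : A) (x : Var) → (r [ a / x ]) x ≡ a
[/]-same r a x with x ≟ x
... | yes _ = refl
... | no x≢x = ⊥-elim (x≢x refl)

[/]-other : (r : Var → A) (a : A) {x y : Var} → y ≢ x → (r [ a / x ]) y ≡ r y
[/]-other r a {x} {y} y≢x with y ≟ x
... | yes y≡x = ⊥-elim (y≢x y≡x)
... | no _    = refl

override : ℕ → (Var → A) → (Var → A) → (Var → A)
override zero    r s = s
override (suc n) r s = override n r (s [ r n / n ])

override-beyond : (n : ℕ) (r s : Var → A) {j : Var} → n ≤ j → override n r s j ≡ s j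
override-beyond zero    r s le = refl
override-beyond (suc n) r s le =
  trans (override-beyond n r (s [ r n / n ]) (<⇒≤ le)) ([/]-other s (r n) (λ e → <-irrefl (sym e) le))

override-Agree : (n : ℕ) (r s : Var → A) → Agree n (override n r s) r
override-Agree (suc n) r s {j} (s≤s j≤n) with j ≟ n
... | yes refl = trans (override-beyond j r (s [ r j / j ]) ≤-refl) ([/]-same s (r j) j)
... | no j≢n   = override-Agree n r (s [ r n / n ]) (≤∧≢⇒< j≤n j≢n)

_⇒_ : FO τ → FO τ → FO τ
φ ⇒ ψ = for (fneg φ) ψ

∀< : ℕ → FO τ → FO τ
∀< zero    θ = θ
∀< (suc n) θ = fall n (∀< n θ)

module _ (M : Structure τ) where

  ⇒-elim : {r : Assignment M} {θ θ' : FO τ} → FOSat M r (θ ⇒ θ') → FOSat M r θ → FOSat M r θ'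
  ⇒-elim (inj₁ ¬p) p = ⊥-elim (¬p p)
  ⇒-elim (inj₂ q)  _ = q

  ⇒-intro : ExcludedMiddle (lsuc 0ℓ) → {r : Assignment M} {θ θ' : FO τ} →
            (FOSat M r θ → FOSat M r θ') → FOSat M r (θ ⇒ θ')
  ⇒-intro em {r} {θ} h with em {Lift (lsuc 0ℓ) (FOSat M r θ)}
  ... | yes (lift p) = inj₂ (h p)
  ... | no ¬p        = inj₁ (λ p → ¬p (lift p))

  ∀<-elim : (n : ℕ) {θ : FO τ} (s : Assignment M) → FOSat M s (∀< n θ) →
            (r : Assignment M) → FOSat M (override n r s) θ
  ∀<-elim zero    s h r = h
  ∀<-elim (suc n) s h r = ∀<-elim n (s [ r n / n ]) (h (r n)) r

  ∀<-intro : (n : ℕ) {θ : FO τ} → ((r : Assignment M) → FOSat M r θ) →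
             (s : Assignment M) → FOSat M s (∀< n θ)
  ∀<-intro zero    h s   = h s
  ∀<-intro (suc n) h s a = ∀<-intro n h (s [ a / n ])

module _ (M : Structure τ) where

  PosPred : Set₁
  PosPred = Assignment M → Sign → SCL τ → Ctx τ → Set

  Winning : PosPred
  Winning r σ χ c = EWin M r σ χ c

  Jump : PosPred → Assignment M → Sign → Maybe (SCL τ × Ctx τ) → Set
  Jump P r σ nothing         = ⊥
  Jump P r σ (just (χ , c')) = P r σ χ c'

  Step : PosPred → PosPred
  Step P r σ     (neg χ)   c = P r (flipSign σ) χ (negF ∷ c)
  Step P r plus  (atom α)  c = AtomSat M r α
  Step P r minus (atom α)  c = ¬ AtomSat M r α
  Step P r plus  (and χ ψ) c = P r plus χ (andL ψ ∷ c) × P r plus ψ (andR χ ∷ c)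
  Step P r minus (and χ ψ) c = P r minus χ (andL ψ ∷ c) ⊎ P r minus ψ (andR χ ∷ c)
  Step P r plus  (or χ ψ)  c = P r plus χ (orL ψ ∷ c) ⊎ P r plus ψ (orR χ ∷ c)
  Step P r minus (or χ ψ)  c = P r minus χ (orL ψ ∷ c) × P r minus ψ (orR χ ∷ c)
  Step P r plus  (ex x χ)  c = Σ (Carrier M) λ a → P (r [ a / x ]) plus χ (exF x ∷ c)
  Step P r minus (ex x χ)  c = (a : Carrier M) → P (r [ a / x ]) minus χ (exF x ∷ c)
  Step P r plus  (all x χ) c = (a : Carrier M) → P (r [ a / x ]) plus χ (allF x ∷ c)
  Step P r minus (all x χ) c = Σ (Carrier M) λ a → P (r [ a / x ]) minus χ (allF x ∷ c)
  Step P r σ     (lab L χ) c = P r σ χ (labF L ∷ c)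
  Step P r σ     (claim L) c = Jump P r σ (refOcc L (claim L) c)

  EWin-step : {r : Assignment M} (σ : Sign) (χ : SCL τ) (c : Ctx τ) → Step Winning r σ χ c → EWin M r σ χ c
  EWin-step plus  (atom α)  c p        = atom+ p
  EWin-step minus (atom α)  c p        = atom- p
  EWin-step σ     (neg χ)   c w        = neg± w
  EWin-step plus  (and χ ψ) c (w , w') = and+ w w'
  EWin-step minus (and χ ψ) c (inj₁ w) = and-l w
  EWin-step minus (and χ ψ) c (inj₂ w) = and-r w
  EWin-step plus  (or χ ψ)  c (inj₁ w) = or+l w
  EWin-step plus  (or χ ψ)  c (inj₂ w) = or+r w
  EWin-step minus (or χ ψ)  c (w , w') = or- w w'
  EWin-step plus  (ex x χ)  c (a , w)  = ex+ a w
  EWin-step minus (ex x χ)  c w        = ex- w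
  EWin-step plus  (all x χ) c w        = all+ w
  EWin-step minus (all x χ) c (a , w)  = all- a w
  EWin-step σ     (lab L χ) c w        = lab± w
  EWin-step σ     (claim L) c w with refOcc L (claim L) c in e
  ... | just (χ' , c') = claim± e w

  EWin-least : (φ : SCL τ) (P : PosPred) →
               (∀ {r} σ χ c → plugAll χ c ≡ φ → Step P r σ χ c → P r σ χ c) →
               ∀ {r σ χ c} → EWin M r σ χ c → plugAll χ c ≡ φ → P r σ χ c
  EWin-least φ P closed = least
    where
    least : ∀ {r σ χ c} → EWin M r σ χ c → plugAll χ c ≡ φ → P r σ χ c
    least (atom+ p)     o = closed _ _ _ o p
    least (atom- p)     o = closed _ _ _ o p
    least (neg± w)      o = closed _ _ _ o (least w o)
    least (and+ w w')   o = closed _ _ _ o (least w o , least w' o)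
    least (and-l w)     o = closed _ _ _ o (inj₁ (least w o))
    least (and-r w)     o = closed _ _ _ o (inj₂ (least w o))
    least (or+l w)      o = closed _ _ _ o (inj₁ (least w o))
    least (or+r w)      o = closed _ _ _ o (inj₂ (least w o))
    least (or- w w')    o = closed _ _ _ o (least w o , least w' o)
    least (ex+ a w)     o = closed _ _ _ o (a , least w o)
    least (ex- w)       o = closed _ _ _ o (λ a → least (w a) o)
    least (all+ w)      o = closed _ _ _ o (λ a → least (w a) o)
    least (all- a w)    o = closed _ _ _ o (a , least w o)
    least (lab± w)      o = closed _ _ _ o (least w o)
    least {r} {σ} {c = c} (claim± {L = L} e w) o =
      closed _ _ _ o (subst (Jump P r σ) (sym e) (least w (trans (refOcc-plugAll (claim L) c e) o)))

  Step-map : {N : ℕ} {P Q : PosPred} {r r' : Assignment M} (σ : Sign) (χ : SCL τ) (c : Ctx τ) →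
             Agree N r r' → VarsBelow N χ →
             (∀ {ρ ρ' σ' χ' c'} → Agree N ρ ρ' → plugAll χ' c' ≡ plugAll χ c → P ρ σ' χ' c' → Q ρ' σ' χ' c') →
             Step P r σ χ c → Step Q r' σ χ c
  Step-map plus  (atom α)  c ag b g p        = AtomSat-Agree M α b ag p
  Step-map minus (atom α)  c ag b g ¬p       = λ p → ¬p (AtomSat-Agree M α b (Agree-sym ag) p)
  Step-map σ     (neg χ)   c ag b g p        = g ag refl p
  Step-map plus  (and χ ψ) c ag b g (p , q)  = g ag refl p , g ag refl q
  Step-map minus (and χ ψ) c ag b g (inj₁ p) = inj₁ (g ag refl p)
  Step-map minus (and χ ψ) c ag b g (inj₂ q) = inj₂ (g ag refl q)
  Step-map plus  (or χ ψ)  c ag b g (inj₁ p) = inj₁ (g ag refl p)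
  Step-map plus  (or χ ψ)  c ag b g (inj₂ q) = inj₂ (g ag refl q)
  Step-map minus (or χ ψ)  c ag b g (p , q)  = g ag refl p , g ag refl q
  Step-map plus  (ex x χ)  c ag b g (a , p)  = a , g (Agree-[/] a x ag) refl p
  Step-map minus (ex x χ)  c ag b g p        = λ a → g (Agree-[/] a x ag) refl (p a)
  Step-map plus  (all x χ) c ag b g p        = λ a → g (Agree-[/] a x ag) refl (p a)
  Step-map minus (all x χ) c ag b g (a , p)  = a , g (Agree-[/] a x ag) refl p
  Step-map σ     (lab L χ) c ag b g p        = g ag refl p
  Step-map σ     (claim L) c ag b g p with refOcc L (claim L) c in e
  ... | just (χ' , c') = g ag (refOcc-plugAll (claim L) c e) p

-- From SCL to ∀SO

codeSize : ℕ → ℕ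
codeSize zero    = 1
codeSize (suc D) = suc (codeSize D + codeSize D)

encode : (D : ℕ) → List Bool → Fin (codeSize D)
encode zero    _        = Fin.zero
encode (suc D) []       = Fin.zero
encode (suc D) (b ∷ bs) = Fin.suc (join _ _ ((if b then inj₂ else inj₁) (encode D bs)))

join-injective : (m n : ℕ) {i j : Fin m ⊎ Fin n} → join m n i ≡ join m n j → i ≡ j
join-injective m n {i} {j} e =
  trans (sym (Finₚ.splitAt-join m n i)) (trans (cong (splitAt m) e) (Finₚ.splitAt-join m n j))

encode-injective : (D : ℕ) {bs bs' : List Bool} → length bs ≤ D → length bs' ≤ D →
                   encode D bs ≡ encode D bs' → bs ≡ bs'
encode-injective zero    {[]}     {[]}       _       _        _ = refl
encode-injective (suc D) {[]}     {[]}       _       _        _ = refl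
encode-injective (suc D) {b ∷ bs} {b' ∷ bs'} (s≤s l) (s≤s l') e =
  by-branch b b' (join-injective _ _ (Finₚ.suc-injective e))
  where
  by-branch : (b b' : Bool) → (if b then inj₂ else inj₁) (encode D bs) ≡ (if b' then inj₂ else inj₁) (encode D bs') →
              b ∷ bs ≡ b' ∷ bs'
  by-branch false false e = cong (false ∷_) (encode-injective D l l' (inj₁-injective e))
  by-branch true  true  e = cong (true ∷_) (encode-injective D l l' (inj₂-injective e))

signBit : Sign → Bool
signBit plus  = false
signBit minus = true

signBit-injective : {σ σ' : Sign} → signBit σ ≡ signBit σ' → σ ≡ σ'
signBit-injective {plus}  {plus}  _ = refl
signBit-injective {minus} {minus} _ = refl

module Translation (em : ExcludedMiddle (lsuc 0ℓ)) {τ : Vocab} (φ : SCL τ) where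

  N : ℕ
  N = bound φ

  K : ℕ
  K = codeSize (suc (depth φ))

  τX : Vocab
  τX = extend τ {K} (λ _ → N)

  code : Sign → Ctx τ → Fin K
  code σ c = encode (suc (depth φ)) (signBit σ ∷ map side c)

  code-length : (σ : Sign) (χ : SCL τ) (c : Ctx τ) → plugAll χ c ≡ φ → length (signBit σ ∷ map side c) ≤ suc (depth φ)
  code-length σ χ c o = s≤s (subst (_≤ depth φ) (sym (length-map side c)) (length≤depth χ c o))

  code-injective : {σ σ' : Sign} {χ χ' : SCL τ} {c c' : Ctx τ} → plugAll χ c ≡ φ → plugAll χ' c' ≡ φ →
                   code σ c ≡ code σ' c' → σ ≡ σ' × χ ≡ χ' × c ≡ c'
  code-injective {σ} {σ'} {χ} {χ'} {c} {c'} o o' e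
    with e-sign , e-path ← ∷-injective
           (encode-injective (suc (depth φ)) (code-length σ χ c o) (code-length σ' χ' c' o') e)
    = signBit-injective e-sign , plugAll-injective e-path (trans o (sym o'))

  VarsBelow-at : (χ : SCL τ) (c : Ctx τ) → plugAll χ c ≡ φ → VarsBelow N χ
  VarsBelow-at χ c o = VarsBelow-plugAll χ c (subst (VarsBelow N) (sym o) (bound-correct φ))

  winAtom : Sign → Ctx τ → FO τX
  winAtom σ c = fatom (rel (inj₂ (code σ c)) (vars N))

  liftAtom : Atom τ → Atom τX
  liftAtom (rel R xs) = rel (inj₁ R) xs
  liftAtom (eq x y)   = eq x y
  liftAtom bot        = bot

  jumpPremise : Sign → Maybe (SCL τ × Ctx τ) → FO τX
  jumpPremise σ nothing         = fatom bot
  jumpPremise σ (just (_ , c')) = winAtom σ c'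

  premise : Sign → SCL τ → Ctx τ → FO τX
  premise σ     (neg χ)   c = winAtom (flipSign σ) (negF ∷ c)
  premise plus  (atom α)  c = fatom (liftAtom α)
  premise minus (atom α)  c = fneg (fatom (liftAtom α))
  premise plus  (and χ ψ) c = fand (winAtom plus (andL ψ ∷ c)) (winAtom plus (andR χ ∷ c))
  premise minus (and χ ψ) c = for (winAtom minus (andL ψ ∷ c)) (winAtom minus (andR χ ∷ c))
  premise plus  (or χ ψ)  c = for (winAtom plus (orL ψ ∷ c)) (winAtom plus (orR χ ∷ c))
  premise minus (or χ ψ)  c = fand (winAtom minus (orL ψ ∷ c)) (winAtom minus (orR χ ∷ c))
  premise plus  (ex x χ)  c = fex x (winAtom plus (exF x ∷ c))
  premise minus (ex x χ)  c = fall x (winAtom minus (exF x ∷ c))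
  premise plus  (all x χ) c = fall x (winAtom plus (allF x ∷ c))
  premise minus (all x χ) c = fex x (winAtom minus (allF x ∷ c))
  premise σ     (lab L χ) c = winAtom σ (labF L ∷ c)
  premise σ     (claim L) c = jumpPremise σ (refOcc L (claim L) c)

  rule : Sign → SCL τ → Ctx τ → FO τX
  rule σ χ c = ∀< N (premise σ χ c ⇒ winAtom σ c)

  rules : SCL τ → Ctx τ → FO τX
  rules χ c = fand (rule plus χ c) (rule minus χ c)

  closure : SCL τ → Ctx τ → FO τX
  closure (atom α)  c = rules (atom α) c
  closure (neg χ)   c = fand (rules (neg χ) c) (closure χ (negF ∷ c))
  closure (and χ ψ) c = fand (rules (and χ ψ) c) (fand (closure χ (andL ψ ∷ c)) (closure ψ (andR χ ∷ c)))
  closure (or χ ψ)  c = fand (rules (or χ ψ) c) (fand (closure χ (orL ψ ∷ c)) (closure ψ (orR χ ∷ c)))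
  closure (ex x χ)  c = fand (rules (ex x χ) c) (closure χ (exF x ∷ c))
  closure (all x χ) c = fand (rules (all x χ) c) (closure χ (allF x ∷ c))
  closure (lab L χ) c = fand (rules (lab L χ) c) (closure χ (labF L ∷ c))
  closure (claim L) c = rules (claim L) c

  translation : ASO τ
  translation = record { k = K ; arX = λ _ → N ; body = closure φ [] ⇒ winAtom plus [] }

  module _ (M : Structure τ) (Xs : (i : Fin K) → Vec (Carrier M) N → Set) where

    MX : Structure τX
    MX = expandStr M (λ _ → N) Xs

    Holds : PosPred M
    Holds r σ χ c = Xs (code σ c) (vmap r (vars N))

    Holds-Agree : {r r' : Assignment M} → Agree N r r' → {i : Fin K} → Xs i (vmap r (vars N)) → Xs i (vmap r' (vars N))
    Holds-Agree ag = subst (Xs _) (vmap-Agree (vars N) (vars-below N) ag)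

    AtomSat-liftAtom : {r : Assignment M} (α : Atom τ) → AtomSat MX r (liftAtom α) ≡ AtomSat M r α
    AtomSat-liftAtom (rel R xs) = refl
    AtomSat-liftAtom (eq x y)   = refl
    AtomSat-liftAtom bot        = refl

    premise-sat : {r : Assignment M} (σ : Sign) (χ : SCL τ) (c : Ctx τ) →
                  FOSat MX r (premise σ χ c) ≡ Step M Holds r σ χ c
    premise-sat σ     (neg χ)   c = refl
    premise-sat plus  (atom α)  c = AtomSat-liftAtom α
    premise-sat minus (atom α)  c = cong ¬_ (AtomSat-liftAtom α)
    premise-sat plus  (and χ ψ) c = refl
    premise-sat minus (and χ ψ) c = refl
    premise-sat plus  (or χ ψ)  c = refl
    premise-sat minus (or χ ψ)  c = refl
    premise-sat plus  (ex x χ)  c = refl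
    premise-sat minus (ex x χ)  c = refl
    premise-sat plus  (all x χ) c = refl
    premise-sat minus (all x χ) c = refl
    premise-sat σ     (lab L χ) c = refl
    premise-sat σ     (claim L) c with refOcc L (claim L) c
    ... | nothing = refl
    ... | just _  = refl

    rules⇒rule : {s : Assignment M} (σ : Sign) (χ : SCL τ) (c : Ctx τ) → FOSat MX s (rules χ c) → FOSat MX s (rule σ χ c)
    rules⇒rule plus  χ c = proj₁
    rules⇒rule minus χ c = proj₂

    closure⇒rules : {s : Assignment M} (χ : SCL τ) (c : Ctx τ) → FOSat MX s (closure χ c) → FOSat MX s (rules χ c)
    closure⇒rules (atom α)  c h = h
    closure⇒rules (neg χ)   c h = proj₁ h
    closure⇒rules (and χ ψ) c h = proj₁ h
    closure⇒rules (or χ ψ)  c h = proj₁ h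
    closure⇒rules (ex x χ)  c h = proj₁ h
    closure⇒rules (all x χ) c h = proj₁ h
    closure⇒rules (lab L χ) c h = proj₁ h
    closure⇒rules (claim L) c h = h

    closure-plug : {s : Assignment M} (f : Frame τ) (χ : SCL τ) (c : Ctx τ) →
                   FOSat MX s (closure (plug f χ) c) → FOSat MX s (closure χ (f ∷ c))
    closure-plug negF     χ c h = proj₂ h
    closure-plug (andL _) χ c h = proj₁ (proj₂ h)
    closure-plug (andR _) χ c h = proj₂ (proj₂ h)
    closure-plug (orL _)  χ c h = proj₁ (proj₂ h)
    closure-plug (orR _)  χ c h = proj₂ (proj₂ h)
    closure-plug (exF _)  χ c h = proj₂ h
    closure-plug (allF _) χ c h = proj₂ h
    closure-plug (labF _) χ c h = proj₂ h

    closure-focus : {s : Assignment M} (χ : SCL τ) (c : Ctx τ) →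
                    FOSat MX s (closure (plugAll χ c) []) → FOSat MX s (closure χ c)
    closure-focus χ []      h = h
    closure-focus χ (f ∷ c) h = closure-plug f χ c (closure-focus (plug f χ) c h)

    closure-intro : {s : Assignment M} (χ : SCL τ) (c : Ctx τ) →
                    (∀ {ψ d} → plugAll ψ d ≡ plugAll χ c → FOSat MX s (rules ψ d)) → FOSat MX s (closure χ c)
    closure-intro (atom α)  c h = h refl
    closure-intro (neg χ)   c h = h refl , closure-intro χ (negF ∷ c) h
    closure-intro (and χ ψ) c h = h refl , closure-intro χ (andL ψ ∷ c) h , closure-intro ψ (andR χ ∷ c) h
    closure-intro (or χ ψ)  c h = h refl , closure-intro χ (orL ψ ∷ c) h , closure-intro ψ (orR χ ∷ c) h
    closure-intro (ex x χ)  c h = h refl , closure-intro χ (exF x ∷ c) h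
    closure-intro (all x χ) c h = h refl , closure-intro χ (allF x ∷ c) h
    closure-intro (lab L χ) c h = h refl , closure-intro χ (labF L ∷ c) h
    closure-intro (claim L) c h = h refl

    rules-at : {s : Assignment M} (χ : SCL τ) (c : Ctx τ) →
               FOSat MX s (closure φ []) → plugAll χ c ≡ φ → FOSat MX s (rules χ c)
    rules-at {s} χ c hc o =
      closure⇒rules χ c (closure-focus χ c (subst (λ θ → FOSat MX s (closure θ [])) (sym o) hc))

    -- The closure yields the rule only at override N r s, which agrees with r below N.
    Holds-closed : (s : Assignment M) → FOSat MX s (closure φ []) →
                   ∀ {r} σ χ c → plugAll χ c ≡ φ → Step M Holds r σ χ c → Holds r σ χ c
    Holds-closed s hc {r} σ χ c o st =
      Holds-Agree r*≈r (⇒-elim MX {θ = premise σ χ c} {winAtom σ c} rule-at-r* premise-holds)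
      where
      r*≈r : Agree N (override N r s) r
      r*≈r = override-Agree N r s
      rule-at-r* : FOSat MX (override N r s) (premise σ χ c ⇒ winAtom σ c)
      rule-at-r* = ∀<-elim MX N s (rules⇒rule σ χ c (rules-at χ c hc o)) r
      premise-holds : FOSat MX (override N r s) (premise σ χ c)
      premise-holds = subst id (sym (premise-sat σ χ c))
                        (Step-map M σ χ c (Agree-sym r*≈r) (VarsBelow-at χ c o) (λ ag _ → Holds-Agree ag) st)

  module _ (M : Structure τ) where

    winners : (i : Fin K) → Vec (Carrier M) N → Set
    winners i v = ∀ {r σ χ c} → vmap r (vars N) ≡ v → plugAll χ c ≡ φ → code σ c ≡ i → EWin M r σ χ c

    winners-closed : ∀ {r} σ χ c → plugAll χ c ≡ φ → Step M (Holds M winners) r σ χ c → Holds M winners r σ χ c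
    winners-closed σ χ c o st {r'} {σ'} {χ'} {c'} e o' ce
      with refl , refl , refl ← code-injective {σ = σ'} {σ} {χ'} {χ} {c'} {c} o' o ce
      = EWin-step M σ χ c
          (Step-map M σ χ c (Agree-sym (vmap-vars⇒Agree N e)) (VarsBelow-at χ c o) winners⇒EWin st)
      where
      winners⇒EWin : ∀ {ρ ρ' σ'' χ'' c''} → Agree N ρ ρ' → plugAll χ'' c'' ≡ plugAll χ c →
                     Holds M winners ρ σ'' χ'' c'' → EWin M ρ' σ'' χ'' c''
      winners⇒EWin ag o'' h = h (vmap-Agree (vars N) (vars-below N) (Agree-sym ag)) (trans o'' o) refl

    winners-rules : {χ : SCL τ} {c : Ctx τ} → plugAll χ c ≡ φ →
                    (s : Assignment M) → FOSat (MX M winners) s (rules χ c)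
    winners-rules {χ} {c} o s =
      ∀<-intro (MX M winners) N (winners-rule plus) s , ∀<-intro (MX M winners) N (winners-rule minus) s
      where
      winners-rule : (σ : Sign) (r : Assignment M) → FOSat (MX M winners) r (premise σ χ c ⇒ winAtom σ c)
      winners-rule σ r = ⇒-intro (MX M winners) em {θ = premise σ χ c} {winAtom σ c}
                           λ p → winners-closed σ χ c o (subst id (premise-sat M winners σ χ c) p)

  translation-correct : Equivalent φ translation
  translation-correct M s = sound , complete
    where
    sound : SCLSat M s φ → ASOSat M s translation
    sound w Xs = ⇒-intro (MX M Xs) em {θ = closure φ []} {winAtom plus []}
                   λ closed → EWin-least M φ (Holds M Xs) (Holds-closed M Xs s closed) w refl
    complete : ASOSat M s translation → SCLSat M s φ
    complete h =
      ⇒-elim (MX M (winners M)) {θ = closure φ []} {winAtom plus []} (h (winners M)) closed refl refl refl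
      where
      closed : FOSat (MX M (winners M)) s (closure φ [])
      closed = closure-intro M (winners M) φ [] (λ o → winners-rules M o s)

-- Transfer of winning strategies

module Transfer {τ : Vocab} (M M' : Structure τ) (N : ℕ)
  (_≈_ : Assignment M → Assignment M' → Set)
  (atom-forth : ∀ {r r'} α → r ≈ r' → AtomVarsBelow N α → AtomSat M r α → AtomSat M' r' α)
  (atom-back  : ∀ {r r'} α → r ≈ r' → AtomVarsBelow N α → AtomSat M' r' α → AtomSat M r α)
  (forth : ∀ {r r'} x → r ≈ r' → (a : Carrier M) → ∃[ b ] (r [ a / x ]) ≈ (r' [ b / x ]))
  (back  : ∀ {r r'} x → r ≈ r' → (b : Carrier M') → ∃[ a ] (r [ a / x ]) ≈ (r' [ b / x ]))
  where

  transfer : ∀ {r r' σ χ c} → EWin M r σ χ c → VarsBelow N (plugAll χ c) → r ≈ r' → EWin M' r' σ χ c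
  transfer {χ = χ} {c} (atom+ {α = α} p) b r≈r' = atom+ (atom-forth α r≈r' (VarsBelow-plugAll χ c b) p)
  transfer {χ = χ} {c} (atom- {α = α} ¬p) b r≈r' = atom- λ p → ¬p (atom-back α r≈r' (VarsBelow-plugAll χ c b) p)
  transfer (neg± w)    b r≈r' = neg± (transfer w b r≈r')
  transfer (and+ w w') b r≈r' = and+ (transfer w b r≈r') (transfer w' b r≈r')
  transfer (and-l w)   b r≈r' = and-l (transfer w b r≈r')
  transfer (and-r w)   b r≈r' = and-r (transfer w b r≈r')
  transfer (or+l w)    b r≈r' = or+l (transfer w b r≈r')
  transfer (or+r w)    b r≈r' = or+r (transfer w b r≈r')
  transfer (or- w w')  b r≈r' = or- (transfer w b r≈r') (transfer w' b r≈r')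
  transfer (all+ {x = x} w) b r≈r' = all+ λ b' → let a , ≈' = back x r≈r' b' in transfer (w a) b ≈'
  transfer (all- {x = x} a w) b r≈r' = let b' , ≈' = forth x r≈r' a in all- b' (transfer w b ≈')
  transfer (ex+ {x = x} a w) b r≈r' = let b' , ≈' = forth x r≈r' a in ex+ b' (transfer w b ≈')
  transfer (ex- {x = x} w) b r≈r' = ex- λ b' → let a , ≈' = back x r≈r' b' in transfer (w a) b ≈'
  transfer (lab± w)    b r≈r' = lab± (transfer w b r≈r')
  transfer {c = c} (claim± {L = L} e w) b r≈r' =
    claim± e (transfer w (subst (VarsBelow N) (sym (refOcc-plugAll (claim L) c e)) b) r≈r')

EqRefines : ℕ → (Var → A) → (Var → B) → Set
EqRefines N r r' = ∀ {u v} → u < N → v < N → r u ≡ r v → r' u ≡ r' v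

SameEqType : ℕ → (Var → A) → (Var → B) → Set
SameEqType N r r' = EqRefines N r r' × EqRefines N r' r

EqRefines-[/] : {N : ℕ} {r : Var → A} {r' : Var → B} {a : A} {b : B} (x : Var) → EqRefines N r r' →
                (∀ {v} → v < N → r v ≡ a → r' v ≡ b) → EqRefines N (r [ a / x ]) (r' [ b / x ])
EqRefines-[/] x ref compat {u} {v} u< v< e with u ≟ x | v ≟ x
... | yes _ | yes _ = refl
... | yes _ | no _  = sym (compat v< (sym e))
... | no _  | yes _ = compat u< e
... | no _  | no _  = ref u< v< e

HasFresh : ℕ → Set → Set
HasFresh N B = (g : Var → B) → ∃[ b ] (∀ {y} → y < N → g y ≢ b)

-- Give x the value of an old variable's partner if a is old, and a fresh value otherwise.
SameEqType-[/] : {N : ℕ} → DecidableEquality A → HasFresh N B → {r : Var → A} {r' : Var → B} (x : Var) →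
                 SameEqType N r r' → (a : A) → ∃[ b ] SameEqType N (r [ a / x ]) (r' [ b / x ])
SameEqType-[/] {N = N} _≟A_ fresh {r} {r'} x (ref , ref') a with anyUpTo? (λ y → r y ≟A a) N
... | yes (y , y< , ry≡a) =
  r' y , EqRefines-[/] x ref (λ v< rv≡a → ref v< y< (trans rv≡a (sym ry≡a)))
       , EqRefines-[/] x ref' (λ v< r'v≡r'y → trans (ref' v< y< r'v≡r'y) ry≡a)
... | no ¬old with fresh r'
...   | b , b-fresh =
  b , EqRefines-[/] x ref (λ v< rv≡a → ⊥-elim (¬old (_ , v< , rv≡a)))
    , EqRefines-[/] x ref' (λ v< r'v≡b → ⊥-elim (b-fresh v< r'v≡b))

maxBelow : ℕ → (Var → ℕ) → ℕ
maxBelow zero    g = 0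
maxBelow (suc N) g = g N ⊔ maxBelow N g

≤-maxBelow : {N : ℕ} (g : Var → ℕ) {y : Var} → y < N → g y ≤ maxBelow N g
≤-maxBelow {suc N} g {y} (s≤s y≤N) with y ≟ N
... | yes refl = m≤m⊔n (g y) (maxBelow N g)
... | no y≢N   = ≤-trans (≤-maxBelow g (≤∧≢⇒< y≤N y≢N)) (m≤n⊔m (g N) (maxBelow N g))

ℕ-hasFresh : {N : ℕ} → HasFresh N ℕ
ℕ-hasFresh {N} g = suc (maxBelow N g) , λ y< e → <-irrefl e (s≤s (≤-maxBelow g y<))

Fin-hasFresh : {N n : ℕ} → N < n → HasFresh N (Fin n)
Fin-hasFresh {N} {n} N<n g with Finₚ.any? (λ c → allUpTo? (λ y → ¬? (g y Finₚ.≟ c)) N)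
... | yes found = found
... | no none   = ⊥-elim (≤⇒≯ (Finₚ.injective⇒≤ {f = index} index-injective) N<n)
  where
  preimage : (c : Fin n) → ∃[ y ] y < N × g y ≡ c
  preimage c = decidable-stable (anyUpTo? (λ y → g y Finₚ.≟ c) N)
                 (λ ¬hit → none (c , λ y< e → ¬hit (_ , y< , e)))
  index : Fin n → Fin N
  index c = fromℕ< (proj₁ (proj₂ (preimage c)))
  index-injective : Injective _≡_ _≡_ index
  index-injective {c} {c'} e = trans (sym (hits c)) (trans (cong g same-preimage) (hits c'))
    where
    hits : (c : Fin n) → g (proj₁ (preimage c)) ≡ c
    hits c = proj₂ (proj₂ (preimage c))
    same-preimage : proj₁ (preimage c) ≡ proj₁ (preimage c')
    same-preimage = trans (sym (Finₚ.toℕ-fromℕ< _)) (trans (cong toℕ e) (Finₚ.toℕ-fromℕ< _))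

Fin-injective⇒surjective : {n : ℕ} (f : Fin n → Fin n) → Injective _≡_ _≡_ f → (c : Fin n) → ∃[ a ] f a ≡ c
Fin-injective⇒surjective {suc n} f f-inj c = decidable-stable (Finₚ.any? (λ a → f a Finₚ.≟ c)) missed⇒⊥
  where
  missed⇒⊥ : ¬ ¬ (∃[ a ] f a ≡ c)
  missed⇒⊥ ¬hit = <-irrefl refl (Finₚ.injective⇒≤ {f = shrink} shrink-injective)
    where
    shrink : Fin (suc n) → Fin n
    shrink a = punchOut {i = c} (λ e → ¬hit (a , sym e))
    shrink-injective : Injective _≡_ _≡_ shrink
    shrink-injective {a} {a'} e =
      f-inj (Finₚ.punchOut-injective {i = c} (λ e → ¬hit (a , sym e)) (λ e → ¬hit (a' , sym e)) e)

-- A ∀SO property not expressible in SCL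

emptyVocab : Vocab
emptyVocab = record { Sym = ⊥ ; ar = λ () }

FinStr : ℕ → Structure emptyVocab
FinStr n = record { Carrier = Fin n ; relOf = λ () }

ℕStr : Structure emptyVocab
ℕStr = record { Carrier = ℕ ; relOf = λ () }

dedekindFinite : ASO emptyVocab
dedekindFinite = record { k = 1 ; arX = λ _ → 2 ; body = fneg (fand total (fand injective (fneg surjective))) }
  where
  F : Var → Var → FO (extend emptyVocab {1} (λ _ → 2))
  F x y = fatom (rel (inj₂ Fin.zero) (x ∷ y ∷ []))
  total injective surjective : FO (extend emptyVocab {1} (λ _ → 2))
  total      = fall 0 (fex 1 (F 0 1))
  injective  = fall 0 (fall 1 (fall 2 (fneg (fand (F 0 2) (fand (F 1 2) (fneg (fatom (eq 0 1))))))))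
  surjective = fall 1 (fex 0 (F 0 1))

FinStr-dedekindFinite : (n : ℕ) (s : Assignment (FinStr n)) → ASOSat (FinStr n) s dedekindFinite
FinStr-dedekindFinite n s Xs (total , injective , ¬surjective) = ¬surjective surjective
  where
  F : Fin n → Fin n → Set
  F a b = Xs Fin.zero (a ∷ b ∷ [])
  f : Fin n → Fin n
  f a = proj₁ (total a)
  F-f : ∀ a → F a (f a)
  F-f a = proj₂ (total a)
  f-injective : Injective _≡_ _≡_ f
  f-injective {a} {b} e with a Finₚ.≟ b
  ... | yes a≡b = a≡b
  ... | no a≢b  = ⊥-elim (injective a b (f a) (F-f a , subst (F b) (sym e) (F-f b) , a≢b))
  surjective : ∀ c → ∃[ a ] F a c
  surjective c with a , refl ← Fin-injective⇒surjective f f-injective c = a , F-f a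

ℕStr-not-dedekindFinite : (s : Assignment ℕStr) → ¬ ASOSat ℕStr s dedekindFinite
ℕStr-not-dedekindFinite s h = h successor (total , injective , ¬surjective)
  where
  successor : Fin 1 → Vec ℕ 2 → Set
  successor Fin.zero (a ∷ b ∷ []) = suc a ≡ b
  total : ∀ a → ∃[ b ] suc a ≡ b
  total a = suc a , refl
  injective : ∀ a b c → ¬ (suc a ≡ c × suc b ≡ c × a ≢ b)
  injective a b c (e , e' , a≢b) = a≢b (suc-injective (trans e (sym e')))
  ¬surjective : ¬ (∀ b → ∃[ a ] suc a ≡ b)
  ¬surjective surjective with surjective 0
  ... | _ , ()

FinStr⇒ℕStr : (φ : SCL emptyVocab) → let N = bound φ in
              SCLSat (FinStr (suc N)) (λ _ → Fin.zero) φ → SCLSat ℕStr (λ _ → 0) φ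
FinStr⇒ℕStr φ w = transfer w (bound-correct φ) ((λ _ _ _ → refl) , (λ _ _ _ → refl))
  where
  N = bound φ
  atom-forth : ∀ {r r'} α → SameEqType N r r' → AtomVarsBelow N α → AtomSat (FinStr (suc N)) r α → AtomSat ℕStr r' α
  atom-forth (eq x y) (ref , _) (x< , y<) = ref x< y<
  atom-forth bot      _         _         = id
  atom-back : ∀ {r r'} α → SameEqType N r r' → AtomVarsBelow N α → AtomSat ℕStr r' α → AtomSat (FinStr (suc N)) r α
  atom-back (eq x y) (_ , ref') (x< , y<) = ref' x< y<
  atom-back bot      _          _         = id
  forth : ∀ {r r'} x → SameEqType N r r' → (a : Fin (suc N)) → ∃[ b ] SameEqType N (r [ a / x ]) (r' [ b / x ])
  forth x = SameEqType-[/] Finₚ._≟_ ℕ-hasFresh x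
  back : ∀ {r r'} x → SameEqType N r r' → (b : ℕ) → ∃[ a ] SameEqType N (r [ a / x ]) (r' [ b / x ])
  back x (ref , ref') b with a , ref″ , ref‴ ← SameEqType-[/] _≟_ (Fin-hasFresh (n<1+n N)) x (ref' , ref) b =
    a , ref‴ , ref″
  open Transfer (FinStr (suc N)) ℕStr N (SameEqType N) atom-forth atom-back forth back

dedekindFinite-not-SCL : ¬ Σ (SCL emptyVocab) (λ φ → Equivalent φ dedekindFinite)
dedekindFinite-not-SCL (φ , φ⇔ψ) =
  ℕStr-not-dedekindFinite (λ _ → 0)
    (proj₁ (φ⇔ψ ℕStr _) (FinStr⇒ℕStr φ (proj₂ (φ⇔ψ (FinStr _) _) (FinStr-dedekindFinite _ (λ _ → Fin.zero)))))

theorem4p10 : ExcludedMiddle (lsuc 0ℓ) →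
    ((τ : Vocab) (φ : SCL τ) → Σ (ASO τ) (λ ψ → Equivalent φ ψ))
    × Σ Vocab (λ τ → Σ (ASO τ) (λ ψ → ¬ Σ (SCL τ) (λ φ → Equivalent φ ψ)))
theorem4p10 em =
  (λ τ φ → Translation.translation em φ , Translation.translation-correct em φ) ,
  emptyVocab , dedekindFinite , dedekindFinite-not-SCL
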